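{- In IITT, let $\Delta \le \Gamma$. (1) If $\vdash \Gamma.\Gamma'$ and $\mathrm{dom}(\Delta)\cap\mathrm{dom}(\Gamma')=\emptyset$, then $\vdash \Delta.\Gamma'$. (2) If $\Gamma\vdash t:T$ then $\Delta\vdash t:T$. (3) If $\Gamma\vdash t=t':T$ then $\Delta\vdash t=t':T$.
   Context: Irrelevant Intensional Type Theory (IITT) is defined as follows. Sorts are $\mathsf{Set}_k$ ($k\in\mathbb{N}$), with $\mathsf{Axiom}=\{(\mathsf{Set}_i,\mathsf{Set}_{i+1})\mid i\in\mathbb{N}\}$ and $\mathsf{Rule}=\{(\mathsf{Set}_i,\mathsf{Set}_j,\mathsf{Set}_{\max(i,j)})\mid i,j\in\mathbb{N}\}$. Annotations are $\star\in\{:,\div\}$ (relevant, irrelevant). Expressions: $t,u,T,U ::= s \mid (x\star U)\to^{s,s'}T \mid x \mid \lambda x\star U.\,t \mid t\star u$, where $(x\star U)\to^{s,s'}T$ is a relevant or irrelevant dependent function type annotated with the sort $s$ of its domain and $s'$ of its codomain, and $t\star u$ is relevant application (also written $t\,u$) or irrelevant application $t\div u$. Expressions are taken modulo $\alpha$-equivalence; $[u/x]t$ is capture-avoiding substitution. Contexts: $\Gamma ::= () \mid \Gamma.\,x\star T$ (variables distinct); $\Gamma.\Delta$ is concatenation, $\mathrm{dom}(\Gamma)$ the set of bound variables. Resurrection $\Gamma^{\oplus}$ replaces each binding $x\div T$ by $x:T$. Abbreviations: $\Gamma\vdash t\div T$ means $\Gamma^\oplus\vdash t:T$; $\Gamma\vdash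 t=t'\div T$ means $\Gamma\vdash t\div T$ and $\Gamma\vdash t'\div T$; $\Gamma\vdash T$ means $\Gamma\vdash T:s$ for some sort $s$; $\Gamma\vdash T=T'$ means $\Gamma\vdash T=T':s$ for some $s$. The judgements $\vdash\Gamma$, $\Gamma\vdash t:T$, $\Gamma\vdash t=t':T$ are defined mutually inductively by: (contexts) $\vdash()$; from $\vdash\Gamma$ and $\Gamma\vdash T$ infer $\vdash\Gamma.x\star T$. (typing) from $\vdash\Gamma$, $(s,s')\in\mathsf{Axiom}$ infer $\Gamma\vdash s:s'$; from $\Gamma\vdash U:s_1$, $\Gamma.x\star U\vdash T:s_2$, $(s_1,s_2,s_3)\in\mathsf{Rule}$ infer $\Gamma\vdash (x\star U)\to^{s_1,s_2}T:s_3$; from $\vdash\Gamma$ and $(x:U)\in\Gamma$ infer $\Gamma\vdash x:U$ (no variable rule for irrelevant bindings); from $\Gamma.x\star U\vdash t:T$ and $\Gamma\vdash (x\star U)\to^{s,s'}T$ infer $\Gamma\vdash \lambda x\star U.t:(x\star U)\to^{s,s'}T$; from $\Gamma\vdash t:(x\star U)\to^{s,s'}T$ and $\Gamma\vdash u\star U$ infer $\Gamma\vdash t\star u:[u/x]T$; from $\Gamma\vdash t:T$ and $\Gamma\vdash T=T'$ infer $\Gamma\vdash t:T'$. (equality) $\beta$: from $\Gamma.x\star U\vdash t:T$ and $\Gamma\vdash u\star U$ infer $\Gamma\vdash(\lambda x\star U.t)\star u=[u/x]t:[u/x]T$; $\eta$: from $\Gamma\vdash t:(x\star U)\to^{s,s'}T$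 infer $\Gamma\vdash t=\lambda x\star U.(t\star x):(x\star U)\to^{s,s'}T$; reflexivity, symmetry, transitivity; from $\Gamma\vdash U=U':s_1$, $\Gamma.x\star U\vdash T=T':s_2$, $(s_1,s_2,s_3)\in\mathsf{Rule}$ infer $\Gamma\vdash (x\star U)\to^{s_1,s_2}T=(x\star U')\to^{s_1,s_2}T':s_3$; from $\Gamma\vdash U=U':s_1$, $\Gamma.x\star U\vdash T:s_2$, $\Gamma.x\star U\vdash t=t':T$ infer $\Gamma\vdash\lambda x\star U.t=\lambda x\star U'.t':(x\star U)\to^{s_1,s_2}T$; from $\Gamma\vdash t=t':(x\star U)\to^{s,s'}T$ and $\Gamma\vdash u=u'\star U$ infer $\Gamma\vdash t\star u=t'\star u':[u/x]T$; from $\Gamma\vdash t=t':T$ and $\Gamma\vdash T=T'$ infer $\Gamma\vdash t=t':T'$. Context extension: for well-formed contexts $\vdash\Delta$ and $\vdash\Gamma$, $\Delta\le\Gamma$ holds iff for every $x\in\mathrm{dom}(\Gamma)$: if $(x:U)\in\Gamma$ then $(x:U)\in\Delta$, and if $(x\div U)\in\Gamma$ then $(x:U)\in\Delta$ or $(x\div U)\in\Delta$. (Thus $\Delta$ may add bindings at any position and may make irrelevant bindings relevant.) -}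

module Defs where

open import Data.Nat using (ℕ; zero; suc; _⊔_; _≟_)
open import Data.List using (List; []; _∷_; _++_)
open import Data.List.Membership.Propositional using (_∈_; _∉_)
open import Data.Product using (∃; Σ; _×_; _,_)
open import Data.Sum using (_⊎_)
open import Data.Empty using (⊥)
open import Relation.Nullary using (yes; no)

-- Syntax of IITT, locally nameless representation.
-- Free variables are names (ℕ); bound variables are de Bruijn indices.
-- This representation is exactly expressions modulo α-equivalence.
-- Sorts Set_k are represented by k : ℕ.

Name : Set
Name = ℕ

data Ann : Set where
  rel : Ann
  irr : Ann

data Tm : Set where
  sort : ℕ → Tm
  pi   : Ann → ℕ → ℕ → Tm → Tm → Tm          -- (x ⋆ U) →^{Set_i,Set_j} T ; T binds bvar 0
  bvar : ℕ → Tm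
  fvar : Name → Tm
  lam  : Ann → Tm → Tm → Tm                  -- λ x ⋆ U. t ; t binds bvar 0
  app  : Ann → Tm → Tm → Tm

fv : Tm → List Name
fv (sort _)      = []
fv (pi _ _ _ U T) = fv U ++ fv T
fv (bvar _)      = []
fv (fvar x)      = x ∷ []
fv (lam _ U t)   = fv U ++ fv t
fv (app _ t u)   = fv t ++ fv u

openRec : ℕ → Tm → Tm → Tm
openRec k u (sort i)        = sort i
openRec k u (pi a i j U T)  = pi a i j (openRec k u U) (openRec (suc k) u T)
openRec k u (bvar n) with k ≟ n
... | yes _ = u
... | no  _ = bvar n
openRec k u (fvar x)        = fvar x
openRec k u (lam a U t)     = lam a (openRec k u U) (openRec (suc k) u t)
openRec k u (app a t v)     = app a (openRec k u t) (openRec k u v)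

-- [u/x]T where T is the body of a binder on x
_[_] : Tm → Tm → Tm
T [ u ] = openRec 0 u T

data Ctx : Set where
  ε   : Ctx
  _▸_⦂[_]_ : Ctx → Name → Ann → Tm → Ctx

_⧺_ : Ctx → Ctx → Ctx
Γ ⧺ ε = Γ
Γ ⧺ (Γ' ▸ x ⦂[ a ] T) = (Γ ⧺ Γ') ▸ x ⦂[ a ] T

dom : Ctx → List Name
dom ε = []
dom (Γ ▸ x ⦂[ _ ] _) = x ∷ dom Γ

_⊕ : Ctx → Ctx
ε ⊕ = ε
(Γ ▸ x ⦂[ _ ] T) ⊕ = (Γ ⊕) ▸ x ⦂[ rel ] T

data _⦂[_]_∈ᶜ_ (x : Name) (a : Ann) (T : Tm) : Ctx → Set where
  here  : ∀ {Γ} → x ⦂[ a ] T ∈ᶜ (Γ ▸ x ⦂[ a ] T)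
  there : ∀ {Γ y b U} → x ⦂[ a ] T ∈ᶜ Γ → x ⦂[ a ] T ∈ᶜ (Γ ▸ y ⦂[ b ] U)

infix 4 ⊢_ _⊢_∶_ _⊢_≡_∶_ _⊢_∶[_]_ _⊢_≡_∶[_]_

data ⊢_ : Ctx → Set
data _⊢_∶_ : Ctx → Tm → Tm → Set
data _⊢_≡_∶_ : Ctx → Tm → Tm → Tm → Set
data _⊢_∶[_]_ : Ctx → Tm → Ann → Tm → Set
data _⊢_≡_∶[_]_ : Ctx → Tm → Tm → Ann → Tm → Set

_⊢ty_ : Ctx → Tm → Set
Γ ⊢ty T = ∃ λ s → Γ ⊢ T ∶ sort s

_⊢_≡ty_ : Ctx → Tm → Tm → Set
Γ ⊢ T ≡ty T' = ∃ λ s → Γ ⊢ T ≡ T' ∶ sort s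

data ⊢_ where
  ⊢ε : ⊢ ε
  ⊢▸ : ∀ {Γ x a T} → ⊢ Γ → Γ ⊢ty T → x ∉ dom Γ → ⊢ (Γ ▸ x ⦂[ a ] T)

data _⊢_∶[_]_ where
  rel-arg : ∀ {Γ u U} → Γ ⊢ u ∶ U → Γ ⊢ u ∶[ rel ] U
  irr-arg : ∀ {Γ u U} → (Γ ⊕) ⊢ u ∶ U → Γ ⊢ u ∶[ irr ] U

data _⊢_≡_∶[_]_ where
  rel-eq : ∀ {Γ u u' U} → Γ ⊢ u ≡ u' ∶ U → Γ ⊢ u ≡ u' ∶[ rel ] U
  irr-eq : ∀ {Γ u u' U} → (Γ ⊕) ⊢ u ∶ U → (Γ ⊕) ⊢ u' ∶ U → Γ ⊢ u ≡ u' ∶[ irr ] U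

-- Binder rules choose a name x for the bound variable (a representative of
-- the α-class): x must not already be bound in Γ and must not occur free in
-- the bodies being opened.

data _⊢_∶_ where
  ty-sort : ∀ {Γ i} → ⊢ Γ → Γ ⊢ sort i ∶ sort (suc i)
  ty-pi   : ∀ {Γ a i j U T} (x : Name) → x ∉ dom Γ → x ∉ fv T →
            Γ ⊢ U ∶ sort i → (Γ ▸ x ⦂[ a ] U) ⊢ T [ fvar x ] ∶ sort j →
            Γ ⊢ pi a i j U T ∶ sort (i ⊔ j)
  ty-var  : ∀ {Γ x U} → ⊢ Γ → x ⦂[ rel ] U ∈ᶜ Γ → Γ ⊢ fvar x ∶ U
  ty-lam  : ∀ {Γ a s s' U T t} (x : Name) → x ∉ dom Γ → x ∉ fv t → x ∉ fv T →
            (Γ ▸ x ⦂[ a ] U) ⊢ t [ fvar x ] ∶ T [ fvar x ] →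
            Γ ⊢ty pi a s s' U T →
            Γ ⊢ lam a U t ∶ pi a s s' U T
  ty-app  : ∀ {Γ a s s' U T t u} →
            Γ ⊢ t ∶ pi a s s' U T → Γ ⊢ u ∶[ a ] U →
            Γ ⊢ app a t u ∶ T [ u ]
  ty-conv : ∀ {Γ t T T'} → Γ ⊢ t ∶ T → Γ ⊢ T ≡ty T' → Γ ⊢ t ∶ T'

data _⊢_≡_∶_ where
  eq-β     : ∀ {Γ a U t T u} (x : Name) → x ∉ dom Γ → x ∉ fv t → x ∉ fv T →
             (Γ ▸ x ⦂[ a ] U) ⊢ t [ fvar x ] ∶ T [ fvar x ] →
             Γ ⊢ u ∶[ a ] U →
             Γ ⊢ app a (lam a U t) u ≡ t [ u ] ∶ T [ u ]
  eq-η     : ∀ {Γ a s s' U T t} →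
             Γ ⊢ t ∶ pi a s s' U T →
             Γ ⊢ t ≡ lam a U (app a t (bvar 0)) ∶ pi a s s' U T
  eq-refl  : ∀ {Γ t T} → Γ ⊢ t ∶ T → Γ ⊢ t ≡ t ∶ T
  eq-sym   : ∀ {Γ t t' T} → Γ ⊢ t ≡ t' ∶ T → Γ ⊢ t' ≡ t ∶ T
  eq-trans : ∀ {Γ t t' t'' T} → Γ ⊢ t ≡ t' ∶ T → Γ ⊢ t' ≡ t'' ∶ T → Γ ⊢ t ≡ t'' ∶ T
  eq-pi    : ∀ {Γ a i j U U' T T'} (x : Name) → x ∉ dom Γ → x ∉ fv T → x ∉ fv T' →
             Γ ⊢ U ≡ U' ∶ sort i →
             (Γ ▸ x ⦂[ a ] U) ⊢ T [ fvar x ] ≡ T' [ fvar x ] ∶ sort j →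
             Γ ⊢ pi a i j U T ≡ pi a i j U' T' ∶ sort (i ⊔ j)
  eq-lam   : ∀ {Γ a i j U U' T t t'} (x : Name) → x ∉ dom Γ →
             x ∉ fv T → x ∉ fv t → x ∉ fv t' →
             Γ ⊢ U ≡ U' ∶ sort i →
             (Γ ▸ x ⦂[ a ] U) ⊢ T [ fvar x ] ∶ sort j →
             (Γ ▸ x ⦂[ a ] U) ⊢ t [ fvar x ] ≡ t' [ fvar x ] ∶ T [ fvar x ] →
             Γ ⊢ lam a U t ≡ lam a U' t' ∶ pi a i j U T
  eq-app   : ∀ {Γ a s s' U T t t' u u'} →
             Γ ⊢ t ≡ t' ∶ pi a s s' U T → Γ ⊢ u ≡ u' ∶[ a ] U →
             Γ ⊢ app a t u ≡ app a t' u' ∶ T [ u ]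
  eq-conv  : ∀ {Γ t t' T T'} → Γ ⊢ t ≡ t' ∶ T → Γ ⊢ T ≡ty T' → Γ ⊢ t ≡ t' ∶ T'

record _≤ᶜ_ (Δ Γ : Ctx) : Set where
  field
    wf-Δ : ⊢ Δ
    wf-Γ : ⊢ Γ
    keep-rel : ∀ {x U} → x ⦂[ rel ] U ∈ᶜ Γ → x ⦂[ rel ] U ∈ᶜ Δ
    keep-irr : ∀ {x U} → x ⦂[ irr ] U ∈ᶜ Γ → (x ⦂[ rel ] U ∈ᶜ Δ) ⊎ (x ⦂[ irr ] U ∈ᶜ Δ)

Disjoint : List Name → List Name → Set
Disjoint xs ys = ∀ {x} → x ∈ xs → x ∈ ys → ⊥

-- Weakening is proved for renamings, not just for the identity: under a binder the
-- bound name is fresh for Γ but may be bound in Δ, so it has to be renamed to a name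
-- fresh for Δ.  A renaming ρ from Γ to Δ sends every binding x ⋆ U of Γ to a binding
-- ρ x ⋆' ρ U of Δ with ⋆' at least as relevant as ⋆.  This invariant survives
-- resurrection of both contexts (needed for irrelevant arguments) and extension by a
-- fresh binder; the latter needs the types of Γ to mention only names bound in Γ, which
-- holds for every derivable judgement.  The identity renaming then gives (2) and (3),
-- as well as ⊢ Δ ⊕ from ⊢ Δ, and (1) follows by induction on Γ'.

module Submission where

open import Defs
open import Function using (id; _∘_)
open import Data.Empty using (⊥-elim)
open import Data.Unit using (⊤; tt)
open import Data.Product using (∃; _×_; _,_; proj₁; proj₂)
open import Data.Sum using (_⊎_; inj₁; inj₂; [_,_]′; map₂)
open import Data.Nat using (suc; _≟_)
open import Data.Nat.Properties using (1+n≰n)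
open import Data.List using (List; []; _∷_; _++_; concat)
open import Data.List.Extrema.Nat using (max; xs≤max)
open import Data.List.Membership.Propositional using (_∈_; _∉_)
open import Data.List.Membership.Propositional.Properties using (∈-++⁺ˡ; ∈-++⁺ʳ; ∈-++⁻; ∈-concat⁺′)
open import Data.List.Relation.Binary.Subset.Propositional using (_⊆_)
open import Data.List.Relation.Binary.Subset.Propositional.Properties using (++⁺; ⊆∷∧∉⇒⊆)
open import Data.List.Relation.Unary.All as All using (All; []; _∷_)
open import Data.List.Relation.Unary.Any using (here; there)
open import Relation.Nullary using (yes; no)
open import Relation.Binary.PropositionalEquality using (refl; sym; subst; subst₂)

-- Propositional equality is only in scope inside this module: next to the
-- judgement Γ ⊢ t ≡ t' ∶ T, the operator _≡_ would make it ambiguous.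
module Syntax where

  open import Relation.Binary.PropositionalEquality using (_≡_; _≢_; cong; cong₂; module ≡-Reasoning)
  open ≡-Reasoning

  fresh : (xss : List (List Name)) → ∃ λ y → All (y ∉_) xss
  fresh xss = suc (max 0 (concat xss)) , All.tabulate λ xs∈xss y∈xs →
    1+n≰n (All.lookup (xs≤max 0 (concat xss)) (∈-concat⁺′ y∈xs xs∈xss))

  ++-⊆ : ∀ {xs ys zs : List Name} → xs ⊆ zs → ys ⊆ zs → xs ++ ys ⊆ zs
  ++-⊆ {xs} xs⊆zs ys⊆zs = [ xs⊆zs , ys⊆zs ]′ ∘ ∈-++⁻ xs

  rename : (Name → Name) → Tm → Tm
  rename ρ (sort i)       = sort i
  rename ρ (pi a i j U T) = pi a i j (rename ρ U) (rename ρ T)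
  rename ρ (bvar n)       = bvar n
  rename ρ (fvar x)       = fvar (ρ x)
  rename ρ (lam a U t)    = lam a (rename ρ U) (rename ρ t)
  rename ρ (app a t u)    = app a (rename ρ t) (rename ρ u)

  rename-open : ∀ ρ k u t → rename ρ (openRec k u t) ≡ openRec k (rename ρ u) (rename ρ t)
  rename-open ρ k u (sort i)       = refl
  rename-open ρ k u (pi a i j U T) = cong₂ (pi a i j) (rename-open ρ k u U) (rename-open ρ (suc k) u T)
  rename-open ρ k u (bvar n) with k ≟ n
  ... | yes _ = refl
  ... | no  _ = refl
  rename-open ρ k u (fvar x)       = refl
  rename-open ρ k u (lam a U t)    = cong₂ (lam a) (rename-open ρ k u U) (rename-open ρ (suc k) u t)
  rename-open ρ k u (app a t v)    = cong₂ (app a) (rename-open ρ k u t) (rename-open ρ k u v)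

  rename-cong : ∀ {ρ σ} t → (∀ {z} → z ∈ fv t → ρ z ≡ σ z) → rename ρ t ≡ rename σ t
  rename-cong (sort i)       eq = refl
  rename-cong (pi a i j U T) eq = cong₂ (pi a i j) (rename-cong U (eq ∘ ∈-++⁺ˡ)) (rename-cong T (eq ∘ ∈-++⁺ʳ (fv U)))
  rename-cong (bvar n)       eq = refl
  rename-cong (fvar x)       eq = cong fvar (eq (here refl))
  rename-cong (lam a U t)    eq = cong₂ (lam a) (rename-cong U (eq ∘ ∈-++⁺ˡ)) (rename-cong t (eq ∘ ∈-++⁺ʳ (fv U)))
  rename-cong (app a t u)    eq = cong₂ (app a) (rename-cong t (eq ∘ ∈-++⁺ˡ)) (rename-cong u (eq ∘ ∈-++⁺ʳ (fv t)))

  rename-id : ∀ t → rename id t ≡ t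
  rename-id (sort i)       = refl
  rename-id (pi a i j U T) = cong₂ (pi a i j) (rename-id U) (rename-id T)
  rename-id (bvar n)       = refl
  rename-id (fvar x)       = refl
  rename-id (lam a U t)    = cong₂ (lam a) (rename-id U) (rename-id t)
  rename-id (app a t u)    = cong₂ (app a) (rename-id t) (rename-id u)

  _[_↦_] : (Name → Name) → Name → Name → Name → Name
  (ρ [ x ↦ y ]) z with z ≟ x
  ... | yes _ = y
  ... | no  _ = ρ z

  [↦]-here : ∀ ρ x y → (ρ [ x ↦ y ]) x ≡ y
  [↦]-here ρ x y with x ≟ x
  ... | yes _   = refl
  ... | no  x≢x = ⊥-elim (x≢x refl)

  [↦]-there : ∀ ρ {x y z} → z ≢ x → (ρ [ x ↦ y ]) z ≡ ρ z
  [↦]-there ρ {x} {z = z} z≢x with z ≟ x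
  ... | yes z≡x = ⊥-elim (z≢x z≡x)
  ... | no  _   = refl

  rename-[↦]-∉ : ∀ ρ {x y} t → x ∉ fv t → rename (ρ [ x ↦ y ]) t ≡ rename ρ t
  rename-[↦]-∉ ρ t x∉t = rename-cong t λ z∈t → [↦]-there ρ λ { refl → x∉t z∈t }

  rename-open-fresh : ∀ ρ {x y} t → x ∉ fv t → rename (ρ [ x ↦ y ]) (t [ fvar x ]) ≡ rename ρ t [ fvar y ]
  rename-open-fresh ρ {x} {y} t x∉t = begin
    rename (ρ [ x ↦ y ]) (t [ fvar x ])                ≡⟨ rename-open (ρ [ x ↦ y ]) 0 (fvar x) t ⟩
    rename (ρ [ x ↦ y ]) t [ fvar ((ρ [ x ↦ y ]) x) ]
      ≡⟨ cong₂ (λ z s → s [ fvar z ]) ([↦]-here ρ x y) (rename-[↦]-∉ ρ t x∉t) ⟩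
    rename ρ t [ fvar y ]                              ∎

  fv-open⁺ : ∀ k u t → fv t ⊆ fv (openRec k u t)
  fv-open⁺ k u (sort i)       ()
  fv-open⁺ k u (pi a i j U T) = ++⁺ (fv-open⁺ k u U) (fv-open⁺ (suc k) u T)
  fv-open⁺ k u (bvar n)       ()
  fv-open⁺ k u (fvar x)       = id
  fv-open⁺ k u (lam a U t)    = ++⁺ (fv-open⁺ k u U) (fv-open⁺ (suc k) u t)
  fv-open⁺ k u (app a t v)    = ++⁺ (fv-open⁺ k u t) (fv-open⁺ k u v)

  fv-open⁻ : ∀ k u t {z} → z ∈ fv (openRec k u t) → z ∈ fv u ⊎ z ∈ fv t
  fv-open⁻ k u (sort i) ()
  fv-open⁻ k u (pi a i j U T) z∈ with ∈-++⁻ (fv (openRec k u U)) z∈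
  ... | inj₁ z∈U = map₂ ∈-++⁺ˡ (fv-open⁻ k u U z∈U)
  ... | inj₂ z∈T = map₂ (∈-++⁺ʳ (fv U)) (fv-open⁻ (suc k) u T z∈T)
  fv-open⁻ k u (bvar n) z∈ with k ≟ n
  fv-open⁻ k u (bvar n) z∈ | yes _ = inj₁ z∈
  fv-open⁻ k u (bvar n) () | no  _
  fv-open⁻ k u (fvar x) z∈ = inj₂ z∈
  fv-open⁻ k u (lam a U t) z∈ with ∈-++⁻ (fv (openRec k u U)) z∈
  ... | inj₁ z∈U = map₂ ∈-++⁺ˡ (fv-open⁻ k u U z∈U)
  ... | inj₂ z∈t = map₂ (∈-++⁺ʳ (fv U)) (fv-open⁻ (suc k) u t z∈t)
  fv-open⁻ k u (app a t v) z∈ with ∈-++⁻ (fv (openRec k u t)) z∈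
  ... | inj₁ z∈t = map₂ ∈-++⁺ˡ (fv-open⁻ k u t z∈t)
  ... | inj₂ z∈v = map₂ (∈-++⁺ʳ (fv t)) (fv-open⁻ k u v z∈v)

  fv-body-⊆ : ∀ {x xs} t → x ∉ fv t → fv (t [ fvar x ]) ⊆ x ∷ xs → fv t ⊆ xs
  fv-body-⊆ t x∉t t⊆ = ⊆∷∧∉⇒⊆ (t⊆ ∘ fv-open⁺ 0 _ t) x∉t

  fv-[]-⊆ : ∀ {xs} u t → fv u ⊆ xs → fv t ⊆ xs → fv (t [ u ]) ⊆ xs
  fv-[]-⊆ u t u⊆ t⊆ = [ u⊆ , t⊆ ]′ ∘ fv-open⁻ 0 u t

  dom-⊕ : ∀ Γ → dom (Γ ⊕) ≡ dom Γ
  dom-⊕ ε                = refl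
  dom-⊕ (Γ ▸ x ⦂[ a ] U) = cong (x ∷_) (dom-⊕ Γ)

  ⊕-idem : ∀ Γ → (Γ ⊕) ⊕ ≡ Γ ⊕
  ⊕-idem ε                = refl
  ⊕-idem (Γ ▸ x ⦂[ a ] U) = cong (_▸ x ⦂[ rel ] U) (⊕-idem Γ)

  dom-⧺ : ∀ Γ Γ' → dom (Γ ⧺ Γ') ≡ dom Γ' ++ dom Γ
  dom-⧺ Γ ε                 = refl
  dom-⧺ Γ (Γ' ▸ x ⦂[ a ] U) = cong (x ∷_) (dom-⧺ Γ Γ')

  ∈ᶜ⇒∈dom : ∀ {x a U Γ} → x ⦂[ a ] U ∈ᶜ Γ → x ∈ dom Γ
  ∈ᶜ⇒∈dom here        = here refl
  ∈ᶜ⇒∈dom (there x∈Γ) = there (∈ᶜ⇒∈dom x∈Γ)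

  ∈ᶜ-⊕⁺ : ∀ {x a U Γ} → x ⦂[ a ] U ∈ᶜ Γ → x ⦂[ rel ] U ∈ᶜ (Γ ⊕)
  ∈ᶜ-⊕⁺ here        = here
  ∈ᶜ-⊕⁺ (there x∈Γ) = there (∈ᶜ-⊕⁺ x∈Γ)

  ∈ᶜ-⊕⁻ : ∀ Γ {x a U} → x ⦂[ a ] U ∈ᶜ (Γ ⊕) → ∃ λ b → x ⦂[ b ] U ∈ᶜ Γ
  ∈ᶜ-⊕⁻ (Γ ▸ _ ⦂[ b ] _) here        = b , here
  ∈ᶜ-⊕⁻ (Γ ▸ _ ⦂[ _ ] _) (there x∈Γ) = let b , x∈ = ∈ᶜ-⊕⁻ Γ x∈Γ in b , there x∈

  ∈ᶜ-⧺⁺ˡ : ∀ {x a U Γ} Γ' → x ⦂[ a ] U ∈ᶜ Γ → x ⦂[ a ] U ∈ᶜ (Γ ⧺ Γ')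
  ∈ᶜ-⧺⁺ˡ ε                 x∈Γ = x∈Γ
  ∈ᶜ-⧺⁺ˡ (Γ' ▸ _ ⦂[ _ ] _) x∈Γ = there (∈ᶜ-⧺⁺ˡ Γ' x∈Γ)

  ∈ᶜ-⧺⁺ʳ : ∀ {x a U Γ} Γ' → x ⦂[ a ] U ∈ᶜ Γ' → x ⦂[ a ] U ∈ᶜ (Γ ⧺ Γ')
  ∈ᶜ-⧺⁺ʳ (Γ' ▸ _ ⦂[ _ ] _) here         = here
  ∈ᶜ-⧺⁺ʳ (Γ' ▸ _ ⦂[ _ ] _) (there x∈Γ') = there (∈ᶜ-⧺⁺ʳ Γ' x∈Γ')

  ∈ᶜ-⧺⁻ : ∀ {x a U Γ} Γ' → x ⦂[ a ] U ∈ᶜ (Γ ⧺ Γ') → x ⦂[ a ] U ∈ᶜ Γ ⊎ x ⦂[ a ] U ∈ᶜ Γ'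
  ∈ᶜ-⧺⁻ ε                 x∈ = inj₁ x∈
  ∈ᶜ-⧺⁻ (Γ' ▸ _ ⦂[ _ ] _) here = inj₂ here
  ∈ᶜ-⧺⁻ (Γ' ▸ _ ⦂[ _ ] _) (there x∈) = map₂ there (∈ᶜ-⧺⁻ Γ' x∈)

open Syntax

Scoped : Ctx → Set
Scoped ε                = ⊤
Scoped (Γ ▸ x ⦂[ a ] U) = Scoped Γ × fv U ⊆ dom Γ

Scoped-⊕ : ∀ Γ → Scoped Γ → Scoped (Γ ⊕)
Scoped-⊕ ε                tt            = tt
Scoped-⊕ (Γ ▸ x ⦂[ a ] U) (Γ-sc , U⊆Γ) = Scoped-⊕ Γ Γ-sc , subst (fv U ⊆_) (sym (dom-⊕ Γ)) U⊆Γ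

∈ᶜ-scoped : ∀ {Γ x a U} → Scoped Γ → x ⦂[ a ] U ∈ᶜ Γ → fv U ⊆ dom Γ
∈ᶜ-scoped (_    , U⊆Γ) here        = there ∘ U⊆Γ
∈ᶜ-scoped (Γ-sc , _)   (there x∈Γ) = there ∘ ∈ᶜ-scoped Γ-sc x∈Γ

⊢-scoped  : ∀ {Γ} → ⊢ Γ → Scoped Γ
∶-scoped  : ∀ {Γ t T} → Γ ⊢ t ∶ T → Scoped Γ × fv t ⊆ dom Γ × fv T ⊆ dom Γ
≡-scoped  : ∀ {Γ t t' T} → Γ ⊢ t ≡ t' ∶ T → Scoped Γ × fv t ⊆ dom Γ × fv t' ⊆ dom Γ × fv T ⊆ dom Γ
∶[]-scoped : ∀ {Γ u a U} → Γ ⊢ u ∶[ a ] U → fv u ⊆ dom Γ × fv U ⊆ dom Γ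
≡[]-scoped : ∀ {Γ u u' a U} → Γ ⊢ u ≡ u' ∶[ a ] U → fv u ⊆ dom Γ × fv u' ⊆ dom Γ × fv U ⊆ dom Γ

⊢-scoped ⊢ε                  = tt
⊢-scoped (⊢▸ ⊢Γ (_ , dT) _) = let _ , T⊆ , _ = ∶-scoped dT in ⊢-scoped ⊢Γ , T⊆

∶-scoped (ty-sort ⊢Γ) = ⊢-scoped ⊢Γ , (λ ()) , (λ ())
∶-scoped (ty-pi {U = U} {T = T} _ _ x∉T dU dT) =
  let Γ-sc , U⊆ , _ = ∶-scoped dU
      _ , T⊆ , _    = ∶-scoped dT
  in Γ-sc , ++-⊆ U⊆ (fv-body-⊆ T x∉T T⊆) , (λ ())
∶-scoped (ty-var ⊢Γ x∈Γ) =
  ⊢-scoped ⊢Γ , (λ { (here refl) → ∈ᶜ⇒∈dom x∈Γ }) , ∈ᶜ-scoped (⊢-scoped ⊢Γ) x∈Γ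
∶-scoped (ty-lam {t = t} _ _ x∉t _ dt (_ , dΠ)) =
  let _ , t⊆ , _    = ∶-scoped dt
      Γ-sc , Π⊆ , _ = ∶-scoped dΠ
  in Γ-sc , ++-⊆ (Π⊆ ∘ ∈-++⁺ˡ) (fv-body-⊆ t x∉t t⊆) , Π⊆
∶-scoped (ty-app {U = U} {T = T} {u = u} dt du) =
  let Γ-sc , t⊆ , Π⊆ = ∶-scoped dt
      u⊆ , _         = ∶[]-scoped du
  in Γ-sc , ++-⊆ t⊆ u⊆ , fv-[]-⊆ u T u⊆ (Π⊆ ∘ ∈-++⁺ʳ (fv U))
∶-scoped (ty-conv dt (_ , dTT')) =
  let Γ-sc , t⊆ , _ = ∶-scoped dt
      _ , _ , T'⊆ , _ = ≡-scoped dTT'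
  in Γ-sc , t⊆ , T'⊆

≡-scoped (eq-β {t = t} {T = T} {u = u} _ _ x∉t x∉T dt du) =
  let (Γ-sc , U⊆) , t⊆ , T⊆ = ∶-scoped dt
      u⊆ , _                 = ∶[]-scoped du
      t⊆Γ                    = fv-body-⊆ t x∉t t⊆
  in Γ-sc , ++-⊆ (++-⊆ U⊆ t⊆Γ) u⊆ , fv-[]-⊆ u t u⊆ t⊆Γ , fv-[]-⊆ u T u⊆ (fv-body-⊆ T x∉T T⊆)
≡-scoped (eq-η {U = U} {t = t} dt) =
  let Γ-sc , t⊆ , Π⊆ = ∶-scoped dt
  in Γ-sc , t⊆ , ++-⊆ {fv U} (Π⊆ ∘ ∈-++⁺ˡ) (++-⊆ {fv t} t⊆ λ ()) , Π⊆
≡-scoped (eq-refl dt) = let Γ-sc , t⊆ , T⊆ = ∶-scoped dt in Γ-sc , t⊆ , t⊆ , T⊆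
≡-scoped (eq-sym d)   = let Γ-sc , t⊆ , t'⊆ , T⊆ = ≡-scoped d in Γ-sc , t'⊆ , t⊆ , T⊆
≡-scoped (eq-trans d d') =
  let Γ-sc , t⊆ , _ , T⊆ = ≡-scoped d
      _ , _ , t''⊆ , _   = ≡-scoped d'
  in Γ-sc , t⊆ , t''⊆ , T⊆
≡-scoped (eq-pi {T = T} {T' = T'} _ _ x∉T x∉T' dU dT) =
  let Γ-sc , U⊆ , U'⊆ , _ = ≡-scoped dU
      _ , T⊆ , T'⊆ , _    = ≡-scoped dT
  in Γ-sc , ++-⊆ U⊆ (fv-body-⊆ T x∉T T⊆) , ++-⊆ U'⊆ (fv-body-⊆ T' x∉T' T'⊆) , (λ ())
≡-scoped (eq-lam {T = T} {t = t} {t' = t'} _ _ x∉T x∉t x∉t' dU dT dt) =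
  let Γ-sc , U⊆ , U'⊆ , _ = ≡-scoped dU
      _ , T⊆ , _          = ∶-scoped dT
      _ , t⊆ , t'⊆ , _    = ≡-scoped dt
  in Γ-sc , ++-⊆ U⊆ (fv-body-⊆ t x∉t t⊆) , ++-⊆ U'⊆ (fv-body-⊆ t' x∉t' t'⊆)
          , ++-⊆ U⊆ (fv-body-⊆ T x∉T T⊆)
≡-scoped (eq-app {U = U} {T = T} {u = u} dt du) =
  let Γ-sc , t⊆ , t'⊆ , Π⊆ = ≡-scoped dt
      u⊆ , u'⊆ , _         = ≡[]-scoped du
  in Γ-sc , ++-⊆ t⊆ u⊆ , ++-⊆ t'⊆ u'⊆ , fv-[]-⊆ u T u⊆ (Π⊆ ∘ ∈-++⁺ʳ (fv U))
≡-scoped (eq-conv d (_ , dTT')) =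
  let Γ-sc , t⊆ , t'⊆ , _ = ≡-scoped d
      _ , _ , T'⊆ , _     = ≡-scoped dTT'
  in Γ-sc , t⊆ , t'⊆ , T'⊆

∶[]-scoped (rel-arg du) = let _ , u⊆ , U⊆ = ∶-scoped du in u⊆ , U⊆
∶[]-scoped {Γ} (irr-arg du) =
  let _ , u⊆ , U⊆ = ∶-scoped du in subst (_ ⊆_) (dom-⊕ Γ) u⊆ , subst (_ ⊆_) (dom-⊕ Γ) U⊆

≡[]-scoped (rel-eq d) = let _ , u⊆ , u'⊆ , U⊆ = ≡-scoped d in u⊆ , u'⊆ , U⊆
≡[]-scoped {Γ} (irr-eq du du') =
  let _ , u⊆ , U⊆ = ∶-scoped du
      _ , u'⊆ , _ = ∶-scoped du'
  in subst (_ ⊆_) (dom-⊕ Γ) u⊆ , subst (_ ⊆_) (dom-⊕ Γ) u'⊆ , subst (_ ⊆_) (dom-⊕ Γ) U⊆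

infix 4 _⊑_

data _⊑_ : Ann → Ann → Set where
  rel⊑    : ∀ {a} → rel ⊑ a
  irr⊑irr : irr ⊑ irr

⊑-refl : ∀ a → a ⊑ a
⊑-refl rel = rel⊑
⊑-refl irr = irr⊑irr

-- ⊢ Δ ⊕ is recorded because irrelevant arguments are typed in the resurrected context.
record Renaming (ρ : Name → Name) (Δ Γ : Ctx) : Set where
  field
    ⊢Δ     : ⊢ Δ
    ⊢Δ⊕    : ⊢ (Δ ⊕)
    scoped : Scoped Γ
    lookup : ∀ {x a U} → x ⦂[ a ] U ∈ᶜ Γ → ∃ λ b → b ⊑ a × ρ x ⦂[ b ] rename ρ U ∈ᶜ Δ
open Renaming

⊢-⊕⊕ : ∀ {Γ} → ⊢ (Γ ⊕) → ⊢ ((Γ ⊕) ⊕)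
⊢-⊕⊕ {Γ} = subst ⊢_ (sym (⊕-idem Γ))

lookup-⊕ : ∀ {ρ Δ Γ x a U} → Renaming ρ Δ Γ → x ⦂[ a ] U ∈ᶜ Γ → ρ x ⦂[ rel ] rename ρ U ∈ᶜ (Δ ⊕)
lookup-⊕ R x∈Γ = let _ , _ , ρx∈Δ = lookup R x∈Γ in ∈ᶜ-⊕⁺ ρx∈Δ

Renaming-⊕ˡ : ∀ {ρ Δ Γ} → Renaming ρ Δ Γ → Renaming ρ (Δ ⊕) Γ
Renaming-⊕ˡ R = record
  { ⊢Δ     = ⊢Δ⊕ R
  ; ⊢Δ⊕    = ⊢-⊕⊕ (⊢Δ⊕ R)
  ; scoped = scoped R
  ; lookup = λ x∈Γ → rel , rel⊑ , lookup-⊕ R x∈Γ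
  }

Renaming-⊕ : ∀ {ρ Δ Γ} → Renaming ρ Δ Γ → Renaming ρ (Δ ⊕) (Γ ⊕)
Renaming-⊕ {Γ = Γ} R = record
  { ⊢Δ     = ⊢Δ⊕ R
  ; ⊢Δ⊕    = ⊢-⊕⊕ (⊢Δ⊕ R)
  ; scoped = Scoped-⊕ Γ (scoped R)
  ; lookup = λ x∈Γ⊕ → rel , rel⊑ , lookup-⊕ R (proj₂ (∈ᶜ-⊕⁻ Γ x∈Γ⊕))
  }

Renaming-extend : ∀ {ρ Δ Γ x y a U} → Renaming ρ Δ Γ → x ∉ dom Γ → y ∉ dom Δ →
  Scoped (Γ ▸ x ⦂[ a ] U) → Δ ⊢ty rename ρ U → (Δ ⊕) ⊢ty rename ρ U →
  Renaming (ρ [ x ↦ y ]) (Δ ▸ y ⦂[ a ] rename ρ U) (Γ ▸ x ⦂[ a ] U)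
Renaming-extend {ρ} {Δ} {Γ} {x} {y} {a} {U} R x∉Γ y∉Δ ΓU-sc@(_ , U⊆Γ) ⊢U ⊢U⊕ = record
  { ⊢Δ     = ⊢▸ (⊢Δ R) ⊢U y∉Δ
  ; ⊢Δ⊕    = ⊢▸ (⊢Δ⊕ R) ⊢U⊕ (subst (y ∉_) (sym (dom-⊕ Δ)) y∉Δ)
  ; scoped = ΓU-sc
  ; lookup = lookup-extended
  }
  where
  x∉ : ∀ V → fv V ⊆ dom Γ → x ∉ fv V
  x∉ V V⊆Γ = x∉Γ ∘ V⊆Γ
  lookup-extended : ∀ {z b V} → z ⦂[ b ] V ∈ᶜ (Γ ▸ x ⦂[ a ] U) →
    ∃ λ c → c ⊑ b × (ρ [ x ↦ y ]) z ⦂[ c ] rename (ρ [ x ↦ y ]) V ∈ᶜ (Δ ▸ y ⦂[ a ] rename ρ U)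
  lookup-extended here = a , ⊑-refl a ,
    subst₂ (λ z V → z ⦂[ a ] V ∈ᶜ _) (sym ([↦]-here ρ x y)) (sym (rename-[↦]-∉ ρ U (x∉ U U⊆Γ))) here
  lookup-extended {V = V} (there z∈Γ) =
    let c , c⊑b , ρz∈Δ = lookup R z∈Γ
    in c , c⊑b , there (subst₂ (λ z V → z ⦂[ c ] V ∈ᶜ Δ)
                          (sym ([↦]-there ρ λ { refl → x∉Γ (∈ᶜ⇒∈dom z∈Γ) }))
                          (sym (rename-[↦]-∉ ρ V (x∉ V (∈ᶜ-scoped (scoped R) z∈Γ)))) ρz∈Δ)

rename-∶    : ∀ {ρ Δ Γ t T} → Renaming ρ Δ Γ → Γ ⊢ t ∶ T → Δ ⊢ rename ρ t ∶ rename ρ T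
rename-≡    : ∀ {ρ Δ Γ t t' T} → Renaming ρ Δ Γ → Γ ⊢ t ≡ t' ∶ T →
  Δ ⊢ rename ρ t ≡ rename ρ t' ∶ rename ρ T
rename-∶[]  : ∀ {ρ Δ Γ u a U} → Renaming ρ Δ Γ → Γ ⊢ u ∶[ a ] U → Δ ⊢ rename ρ u ∶[ a ] rename ρ U
rename-≡[]  : ∀ {ρ Δ Γ u u' a U} → Renaming ρ Δ Γ → Γ ⊢ u ≡ u' ∶[ a ] U →
  Δ ⊢ rename ρ u ≡ rename ρ u' ∶[ a ] rename ρ U
rename-body-∶ : ∀ {ρ Δ Γ x y a U t T} → Renaming ρ Δ Γ → x ∉ dom Γ → y ∉ dom Δ → x ∉ fv t → x ∉ fv T →
  (Γ ▸ x ⦂[ a ] U) ⊢ t [ fvar x ] ∶ T [ fvar x ] →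
  (Δ ▸ y ⦂[ a ] rename ρ U) ⊢ rename ρ t [ fvar y ] ∶ rename ρ T [ fvar y ]
rename-body-≡ : ∀ {ρ Δ Γ x y a U t t' T} → Renaming ρ Δ Γ → x ∉ dom Γ → y ∉ dom Δ →
  x ∉ fv t → x ∉ fv t' → x ∉ fv T →
  (Γ ▸ x ⦂[ a ] U) ⊢ t [ fvar x ] ≡ t' [ fvar x ] ∶ T [ fvar x ] →
  (Δ ▸ y ⦂[ a ] rename ρ U) ⊢ rename ρ t [ fvar y ] ≡ rename ρ t' [ fvar y ] ∶ rename ρ T [ fvar y ]

-- A derivation over Γ.x⋆U, Ξ contains one of Γ ⊢ U.  Renaming that subderivation
-- in place, rather than extracting it by a lemma first, keeps the recursion structural.
binder-type-⊢ : ∀ {ρ Δ Γ x a U} Ξ → Renaming ρ Δ Γ → ⊢ ((Γ ▸ x ⦂[ a ] U) ⧺ Ξ) →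
  Δ ⊢ty rename ρ U × (Δ ⊕) ⊢ty rename ρ U
binder-type-∶ : ∀ {ρ Δ Γ x a U t T} Ξ → Renaming ρ Δ Γ → ((Γ ▸ x ⦂[ a ] U) ⧺ Ξ) ⊢ t ∶ T →
  Δ ⊢ty rename ρ U × (Δ ⊕) ⊢ty rename ρ U
binder-type-≡ : ∀ {ρ Δ Γ x a U t t' T} Ξ → Renaming ρ Δ Γ → ((Γ ▸ x ⦂[ a ] U) ⧺ Ξ) ⊢ t ≡ t' ∶ T →
  Δ ⊢ty rename ρ U × (Δ ⊕) ⊢ty rename ρ U

rename-∶ R (ty-sort _) = ty-sort (⊢Δ R)
rename-∶ R (ty-var _ x∈Γ) with lookup R x∈Γ
... | _ , rel⊑ , ρx∈Δ = ty-var (⊢Δ R) ρx∈Δ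
rename-∶ {ρ} {Δ} R (ty-pi {j = j} {T = T} x x∉Γ x∉T dU dT) with fresh (dom Δ ∷ fv (rename ρ T) ∷ [])
... | y , y∉Δ ∷ y∉T ∷ [] =
  ty-pi y y∉Δ y∉T (rename-∶ R dU) (rename-body-∶ {t = T} {T = sort j} R x∉Γ y∉Δ x∉T (λ ()) dT)
rename-∶ {ρ} {Δ} R (ty-lam {T = T} {t = t} x x∉Γ x∉t x∉T dt (s , dΠ))
  with fresh (dom Δ ∷ fv (rename ρ t) ∷ fv (rename ρ T) ∷ [])
... | y , y∉Δ ∷ y∉t ∷ y∉T ∷ [] =
  ty-lam y y∉Δ y∉t y∉T (rename-body-∶ {t = t} {T = T} R x∉Γ y∉Δ x∉t x∉T dt) (s , rename-∶ R dΠ)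
rename-∶ {ρ} R (ty-app {T = T} {u = u} dt du) =
  subst (_⊢_∶_ _ _) (sym (rename-open ρ 0 u T)) (ty-app (rename-∶ R dt) (rename-∶[] R du))
rename-∶ R (ty-conv dt (s , dTT')) = ty-conv (rename-∶ R dt) (s , rename-≡ R dTT')

rename-≡ {ρ} {Δ} R (eq-β {t = t} {T = T} {u = u} x x∉Γ x∉t x∉T dt du)
  with fresh (dom Δ ∷ fv (rename ρ t) ∷ fv (rename ρ T) ∷ [])
... | y , y∉Δ ∷ y∉t ∷ y∉T ∷ [] =
  subst₂ (_⊢_≡_∶_ _ _) (sym (rename-open ρ 0 u t)) (sym (rename-open ρ 0 u T))
    (eq-β {T = rename ρ T} y y∉Δ y∉t y∉T (rename-body-∶ {t = t} {T = T} R x∉Γ y∉Δ x∉t x∉T dt) (rename-∶[] R du))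
rename-≡ R (eq-η dt)        = eq-η (rename-∶ R dt)
rename-≡ R (eq-refl dt)     = eq-refl (rename-∶ R dt)
rename-≡ R (eq-sym d)       = eq-sym (rename-≡ R d)
rename-≡ R (eq-trans d d')  = eq-trans (rename-≡ R d) (rename-≡ R d')
rename-≡ {ρ} {Δ} R (eq-pi {j = j} {T = T} {T' = T'} x x∉Γ x∉T x∉T' dU dT)
  with fresh (dom Δ ∷ fv (rename ρ T) ∷ fv (rename ρ T') ∷ [])
... | y , y∉Δ ∷ y∉T ∷ y∉T' ∷ [] =
  eq-pi y y∉Δ y∉T y∉T' (rename-≡ R dU)
    (rename-body-≡ {t = T} {t' = T'} {T = sort j} R x∉Γ y∉Δ x∉T x∉T' (λ ()) dT)
rename-≡ {ρ} {Δ} R (eq-lam {j = j} {T = T} {t = t} {t' = t'} x x∉Γ x∉T x∉t x∉t' dU dT dt)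
  with fresh (dom Δ ∷ fv (rename ρ T) ∷ fv (rename ρ t) ∷ fv (rename ρ t') ∷ [])
... | y , y∉Δ ∷ y∉T ∷ y∉t ∷ y∉t' ∷ [] =
  eq-lam y y∉Δ y∉T y∉t y∉t' (rename-≡ R dU)
    (rename-body-∶ {t = T} {T = sort j} R x∉Γ y∉Δ x∉T (λ ()) dT)
    (rename-body-≡ {t = t} {t' = t'} {T = T} R x∉Γ y∉Δ x∉t x∉t' x∉T dt)
rename-≡ {ρ} R (eq-app {T = T} {u = u} dt du) =
  subst (_⊢_≡_∶_ _ _ _) (sym (rename-open ρ 0 u T)) (eq-app (rename-≡ R dt) (rename-≡[] R du))
rename-≡ R (eq-conv d (s , dTT')) = eq-conv (rename-≡ R d) (s , rename-≡ R dTT')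

rename-∶[] R (rel-arg du) = rel-arg (rename-∶ R du)
rename-∶[] R (irr-arg du) = irr-arg (rename-∶ (Renaming-⊕ R) du)

rename-≡[] R (rel-eq d)       = rel-eq (rename-≡ R d)
rename-≡[] R (irr-eq du du') = irr-eq (rename-∶ (Renaming-⊕ R) du) (rename-∶ (Renaming-⊕ R) du')

rename-body-∶ {ρ} {Δ} {Γ} {x} {y} {a} {U} {t} {T} R x∉Γ y∉Δ x∉t x∉T dt =
  subst₂ (_⊢_∶_ _) (rename-open-fresh ρ t x∉t) (rename-open-fresh ρ T x∉T) (rename-∶ R′ dt)
  where
  R′ : Renaming (ρ [ x ↦ y ]) (Δ ▸ y ⦂[ a ] rename ρ U) (Γ ▸ x ⦂[ a ] U)
  R′ = let ⊢U , ⊢U⊕ = binder-type-∶ ε R dt in Renaming-extend R x∉Γ y∉Δ (proj₁ (∶-scoped dt)) ⊢U ⊢U⊕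

rename-body-≡ {ρ} {Δ} {Γ} {x} {y} {a} {U} {t} {t'} {T} R x∉Γ y∉Δ x∉t x∉t' x∉T d =
  subst₂ (λ s s' → _ ⊢ s ≡ s' ∶ _) (rename-open-fresh ρ t x∉t) (rename-open-fresh ρ t' x∉t')
    (subst (_⊢_≡_∶_ _ _ _) (rename-open-fresh ρ T x∉T) (rename-≡ R′ d))
  where
  R′ : Renaming (ρ [ x ↦ y ]) (Δ ▸ y ⦂[ a ] rename ρ U) (Γ ▸ x ⦂[ a ] U)
  R′ = let ⊢U , ⊢U⊕ = binder-type-≡ ε R d in Renaming-extend R x∉Γ y∉Δ (proj₁ (≡-scoped d)) ⊢U ⊢U⊕

binder-type-⊢ ε R (⊢▸ _ (s , dU) _) = (s , rename-∶ R dU) , (s , rename-∶ (Renaming-⊕ˡ R) dU)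
binder-type-⊢ (Ξ ▸ _ ⦂[ _ ] _) R (⊢▸ ⊢Ξ _ _) = binder-type-⊢ Ξ R ⊢Ξ

binder-type-∶ Ξ R (ty-sort ⊢Ξ)                   = binder-type-⊢ Ξ R ⊢Ξ
binder-type-∶ Ξ R (ty-pi _ _ _ dU _)             = binder-type-∶ Ξ R dU
binder-type-∶ Ξ R (ty-var ⊢Ξ _)                  = binder-type-⊢ Ξ R ⊢Ξ
binder-type-∶ Ξ R (ty-lam _ _ _ _ _ (_ , dΠ))    = binder-type-∶ Ξ R dΠ
binder-type-∶ Ξ R (ty-app dt _)                  = binder-type-∶ Ξ R dt
binder-type-∶ Ξ R (ty-conv dt _)                 = binder-type-∶ Ξ R dt

binder-type-≡ Ξ R (eq-β {a = a} {U = U} x _ _ _ dt _) = binder-type-∶ (Ξ ▸ x ⦂[ a ] U) R dt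
binder-type-≡ Ξ R (eq-η dt)                  = binder-type-∶ Ξ R dt
binder-type-≡ Ξ R (eq-refl dt)               = binder-type-∶ Ξ R dt
binder-type-≡ Ξ R (eq-sym d)                 = binder-type-≡ Ξ R d
binder-type-≡ Ξ R (eq-trans d _)             = binder-type-≡ Ξ R d
binder-type-≡ Ξ R (eq-pi _ _ _ _ dU _)       = binder-type-≡ Ξ R dU
binder-type-≡ Ξ R (eq-lam _ _ _ _ _ dU _ _)  = binder-type-≡ Ξ R dU
binder-type-≡ Ξ R (eq-app d _)               = binder-type-≡ Ξ R d
binder-type-≡ Ξ R (eq-conv d _)              = binder-type-≡ Ξ R d

infix 4 _⊇ᶜ_

_⊇ᶜ_ : Ctx → Ctx → Set
Δ ⊇ᶜ Γ = ∀ {x a U} → x ⦂[ a ] U ∈ᶜ Γ → ∃ λ b → b ⊑ a × x ⦂[ b ] U ∈ᶜ Δ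

⊇ᶜ⇒Renaming : ∀ {Δ Γ} → ⊢ Δ → ⊢ (Δ ⊕) → Scoped Γ → Δ ⊇ᶜ Γ → Renaming id Δ Γ
⊇ᶜ⇒Renaming {Δ} ⊢Δ ⊢Δ⊕ Γ-sc Δ⊇Γ = record
  { ⊢Δ     = ⊢Δ
  ; ⊢Δ⊕    = ⊢Δ⊕
  ; scoped = Γ-sc
  ; lookup = λ {x} {a} {U} x∈Γ → let b , b⊑a , x∈Δ = Δ⊇Γ x∈Γ
                                 in b , b⊑a , subst (λ V → x ⦂[ b ] V ∈ᶜ Δ) (sym (rename-id U)) x∈Δ
  }

weaken-∶ : ∀ {Δ Γ t T} → ⊢ Δ → ⊢ (Δ ⊕) → Δ ⊇ᶜ Γ → Γ ⊢ t ∶ T → Δ ⊢ t ∶ T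
weaken-∶ {t = t} {T} ⊢Δ ⊢Δ⊕ Δ⊇Γ d =
  subst₂ (_⊢_∶_ _) (rename-id t) (rename-id T) (rename-∶ (⊇ᶜ⇒Renaming ⊢Δ ⊢Δ⊕ (proj₁ (∶-scoped d)) Δ⊇Γ) d)

weaken-≡ : ∀ {Δ Γ t t' T} → ⊢ Δ → ⊢ (Δ ⊕) → Δ ⊇ᶜ Γ → Γ ⊢ t ≡ t' ∶ T → Δ ⊢ t ≡ t' ∶ T
weaken-≡ {t = t} {t'} {T} ⊢Δ ⊢Δ⊕ Δ⊇Γ d =
  subst₂ (λ s s' → _ ⊢ s ≡ s' ∶ _) (rename-id t) (rename-id t')
    (subst (_⊢_≡_∶_ _ _ _) (rename-id T) (rename-≡ (⊇ᶜ⇒Renaming ⊢Δ ⊢Δ⊕ (proj₁ (≡-scoped d)) Δ⊇Γ) d))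

⊕-⊇ᶜ : ∀ Γ → Γ ⊕ ⊇ᶜ Γ
⊕-⊇ᶜ Γ x∈Γ = rel , rel⊑ , ∈ᶜ-⊕⁺ x∈Γ

⊢-⊕ : ∀ {Γ} → ⊢ Γ → ⊢ (Γ ⊕)
⊢-⊕ ⊢ε = ⊢ε
⊢-⊕ {Γ ▸ x ⦂[ a ] T} (⊢▸ ⊢Γ (s , dT) x∉Γ) =
  ⊢▸ (⊢-⊕ ⊢Γ) (s , weaken-∶ (⊢-⊕ ⊢Γ) (⊢-⊕⊕ (⊢-⊕ ⊢Γ)) (⊕-⊇ᶜ Γ) dT)
     (subst (x ∉_) (sym (dom-⊕ Γ)) x∉Γ)

≤ᶜ⇒⊇ᶜ : ∀ {Δ Γ} → Δ ≤ᶜ Γ → Δ ⊇ᶜ Γ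
≤ᶜ⇒⊇ᶜ Δ≤Γ {a = rel} x∈Γ = rel , rel⊑ , _≤ᶜ_.keep-rel Δ≤Γ x∈Γ
≤ᶜ⇒⊇ᶜ Δ≤Γ {a = irr} x∈Γ with _≤ᶜ_.keep-irr Δ≤Γ x∈Γ
... | inj₁ x∈Δ = rel , rel⊑ , x∈Δ
... | inj₂ x∈Δ = irr , irr⊑irr , x∈Δ

⊇ᶜ-⧺ : ∀ {Δ Γ} Γ' → Δ ⊇ᶜ Γ → Δ ⧺ Γ' ⊇ᶜ Γ ⧺ Γ'
⊇ᶜ-⧺ Γ' Δ⊇Γ {a = a} x∈ΓΓ' with ∈ᶜ-⧺⁻ Γ' x∈ΓΓ'
... | inj₁ x∈Γ  = let b , b⊑a , x∈Δ = Δ⊇Γ x∈Γ in b , b⊑a , ∈ᶜ-⧺⁺ˡ Γ' x∈Δ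
... | inj₂ x∈Γ' = a , ⊑-refl a , ∈ᶜ-⧺⁺ʳ Γ' x∈Γ'

⊢-⧺ : ∀ {Δ Γ} → ⊢ Δ → Δ ⊇ᶜ Γ →
  ∀ Γ' → ⊢ (Γ ⧺ Γ') → Disjoint (dom Δ) (dom Γ') → ⊢ (Δ ⧺ Γ')
⊢-⧺ ⊢Δ Δ⊇Γ ε _ _ = ⊢Δ
⊢-⧺ {Δ} {Γ} ⊢Δ Δ⊇Γ (Γ' ▸ x ⦂[ a ] T) (⊢▸ ⊢ΓΓ' (s , dT) x∉ΓΓ') disjoint =
  ⊢▸ ⊢ΔΓ' (s , weaken-∶ ⊢ΔΓ' (⊢-⊕ ⊢ΔΓ') (⊇ᶜ-⧺ Γ' Δ⊇Γ) dT) x∉ΔΓ'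
  where
  ⊢ΔΓ' : ⊢ (Δ ⧺ Γ')
  ⊢ΔΓ' = ⊢-⧺ ⊢Δ Δ⊇Γ Γ' ⊢ΓΓ' (λ z∈Δ z∈Γ' → disjoint z∈Δ (there z∈Γ'))
  x∉ΔΓ' : x ∉ dom (Δ ⧺ Γ')
  x∉ΔΓ' x∈ΔΓ' with ∈-++⁻ (dom Γ') (subst (x ∈_) (dom-⧺ Δ Γ') x∈ΔΓ')
  ... | inj₁ x∈Γ' = x∉ΓΓ' (subst (x ∈_) (sym (dom-⧺ Γ Γ')) (∈-++⁺ˡ x∈Γ'))
  ... | inj₂ x∈Δ  = disjoint x∈Δ (here refl)

lemma2p2 : ∀ {Δ Γ : Ctx} → Δ ≤ᶜ Γ →
    ((∀ (Γ' : Ctx) → ⊢ (Γ ⧺ Γ') → Disjoint (dom Δ) (dom Γ') → ⊢ (Δ ⧺ Γ'))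
    × (∀ {t T : Tm} → Γ ⊢ t ∶ T → Δ ⊢ t ∶ T)
    × (∀ {t t' T : Tm} → Γ ⊢ t ≡ t' ∶ T → Δ ⊢ t ≡ t' ∶ T))
lemma2p2 {Δ} {Γ} Δ≤Γ =
  ⊢-⧺ wf-Δ Δ⊇Γ , weaken-∶ wf-Δ (⊢-⊕ wf-Δ) Δ⊇Γ , weaken-≡ wf-Δ (⊢-⊕ wf-Δ) Δ⊇Γ
  where
  open _≤ᶜ_ Δ≤Γ using (wf-Δ)
  Δ⊇Γ : Δ ⊇ᶜ Γ
  Δ⊇Γ = ≤ᶜ⇒⊇ᶜ Δ≤Γ
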